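{- Let $R$ be a commutative ring with identity $1\neq 0$ and $I$ an ideal of $R$. Then $\alpha(\Gamma(R/I))\leq \alpha(\Gamma_I(R))$.
   Context: $\Gamma(S)$ denotes the zero-divisor graph of a commutative ring $S$: vertices are the nonzero zero-divisors of $S$, two distinct vertices $x,y$ adjacent iff $xy=0$. The ideal-based zero-divisor graph $\Gamma_I(R)$ has vertex set $\{x\in R\setminus I : xy\in I \text{ for some } y\in R\setminus I\}$, two distinct vertices $x,y$ adjacent iff $xy\in I$. $\alpha(G)$ is the independence number of $G$ (maximum cardinality of a set of pairwise non-adjacent vertices). -}

module Defs where

open import Level using (Level; _⊔_) renaming (suc to lsuc)
open import Algebra.Bundles using (CommutativeRing)
open import Data.Product using (Σ; ∃; _×_; proj₁; _,_)
open import Relation.Nullary using (¬_)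
open import Relation.Binary.PropositionalEquality using (_≡_; _≢_)
open import Function.Bundles using (_↣_)
open import Relation.Binary.Structures using (IsEquivalence)

private variable c ℓ i a v e q : Level

record Ideal (R : CommutativeRing c ℓ) (i : Level) : Set (c ⊔ ℓ ⊔ lsuc i) where
  open CommutativeRing R
  field
    _∈I        : Carrier → Set i
    ∈I-resp    : ∀ {x y} → x ≈ y → x ∈I → y ∈I
    0∈I        : 0# ∈I
    +-closed   : ∀ {x y} → x ∈I → y ∈I → (x + y) ∈I
    -‿closed   : ∀ {x} → x ∈I → (- x) ∈I
    *-absorb   : ∀ r {x} → x ∈I → (r * x) ∈I

module QuotientProofs (R : CommutativeRing c ℓ) (I : Ideal R i) where
  open CommutativeRing R
  open Ideal I
  open import Algebra.Properties.Ring ring using (x[y-z]≈xy-xz; [y-z]x≈yx-zx)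
  open import Algebra.Properties.AbelianGroup +-abelianGroup
    using (⁻¹-anti-homo‿-; ⁻¹-∙-comm)
  open import Algebra.Properties.CommutativeSemigroup +-commutativeSemigroup
    using (interchange)
  open import Relation.Binary.Reasoning.Setoid setoid

  _~_ : Carrier → Carrier → Set i
  x ~ y = (x - y) ∈I

  ≈⇒~ : ∀ {x y} → x ≈ y → x ~ y
  ≈⇒~ {x} {y} x≈y = ∈I-resp
    (trans (sym (-‿inverseʳ y)) (+-congʳ (sym x≈y)))
    0∈I

  ~-refl : ∀ {x} → x ~ x
  ~-refl = ≈⇒~ refl

  ~-sym : ∀ {x y} → x ~ y → y ~ x
  ~-sym {x} {y} p = ∈I-resp (⁻¹-anti-homo‿- x y) (-‿closed p)

  ~-trans : ∀ {x y z} → x ~ y → y ~ z → x ~ z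
  ~-trans {x} {y} {z} p q = ∈I-resp eq (+-closed p q)
    where
    eq : (x - y) + (y - z) ≈ x - z
    eq = begin
      (x - y) + (y - z)   ≈⟨ +-assoc x (- y) (y - z) ⟩
      x + (- y + (y - z)) ≈⟨ +-congˡ (sym (+-assoc (- y) y (- z))) ⟩
      x + ((- y + y) - z) ≈⟨ +-congˡ (+-congʳ (-‿inverseˡ y)) ⟩
      x + (0# - z)        ≈⟨ +-congˡ (+-identityˡ (- z)) ⟩
      x - z               ∎

  +-cong~ : ∀ {x y u w} → x ~ y → u ~ w → (x + u) ~ (y + w)
  +-cong~ {x} {y} {u} {w} p q = ∈I-resp eq (+-closed p q)
    where
    eq : (x - y) + (u - w) ≈ (x + u) - (y + w)
    eq = begin
      (x - y) + (u - w)       ≈⟨ interchange x (- y) u (- w) ⟩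
      (x + u) + (- y + - w)   ≈⟨ +-congˡ (⁻¹-∙-comm y w) ⟩
      (x + u) - (y + w)       ∎

  *-congˡ~ : ∀ x {u w} → u ~ w → (x * u) ~ (x * w)
  *-congˡ~ x {u} {w} q = ∈I-resp (x[y-z]≈xy-xz x u w) (*-absorb x q)

  *-congʳ~ : ∀ w {x y} → x ~ y → (x * w) ~ (y * w)
  *-congʳ~ w {x} {y} p =
    ∈I-resp (trans (*-comm w (x - y)) ([y-z]x≈yx-zx w x y)) (*-absorb w p)

  *-cong~ : ∀ {x y u w} → x ~ y → u ~ w → (x * u) ~ (y * w)
  *-cong~ {x} {y} {u} {w} p q = ~-trans (*-congˡ~ x q) (*-congʳ~ w p)

  -‿cong~ : ∀ {x y} → x ~ y → (- x) ~ (- y)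
  -‿cong~ {x} {y} p = ∈I-resp eq (-‿closed p)
    where
    eq : - (x - y) ≈ - x - - y
    eq = trans (⁻¹-anti-homo‿- x y) (trans (+-comm y (- x)) (+-congˡ (sym (-‿involutive' y))))
      where
      open import Algebra.Properties.Group +-group renaming (⁻¹-involutive to -‿involutive')

_/_ : (R : CommutativeRing c ℓ) → Ideal R i → CommutativeRing c i
R / I = record
  { Carrier = Carrier
  ; _≈_ = _~_
  ; _+_ = _+_ ; _*_ = _*_ ; -_ = -_ ; 0# = 0# ; 1# = 1#
  ; isCommutativeRing = record
    { isRing = record
      { +-isAbelianGroup = record
        { isGroup = record
          { isMonoid = record
            { isSemigroup = record
              { isMagma = record { isEquivalence = eq ; ∙-cong = +-cong~ }
              ; assoc = λ x y z → ≈⇒~ (+-assoc x y z) }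
            ; identity = (λ x → ≈⇒~ (+-identityˡ x)) , (λ x → ≈⇒~ (+-identityʳ x)) }
          ; inverse = (λ x → ≈⇒~ (-‿inverseˡ x)) , (λ x → ≈⇒~ (-‿inverseʳ x))
          ; ⁻¹-cong = -‿cong~ }
        ; comm = λ x y → ≈⇒~ (+-comm x y) }
      ; *-cong = *-cong~
      ; *-assoc = λ x y z → ≈⇒~ (*-assoc x y z)
      ; *-identity = (λ x → ≈⇒~ (*-identityˡ x)) , (λ x → ≈⇒~ (*-identityʳ x))
      ; distrib = (λ x y z → ≈⇒~ (distribˡ x y z)) , (λ x y z → ≈⇒~ (distribʳ x y z)) }
    ; *-comm = λ x y → ≈⇒~ (*-comm x y) } }
  where
  open CommutativeRing R
  open QuotientProofs R I
  eq : IsEquivalence _~_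
  eq = record { refl = ~-refl ; sym = ~-sym ; trans = ~-trans }

record Graph (v q e : Level) : Set (lsuc (v ⊔ q ⊔ e)) where
  field
    Vertex : Set v
    _≈V_   : Vertex → Vertex → Set q
    Adj    : Vertex → Vertex → Set e

Γ : CommutativeRing c ℓ → Graph (c ⊔ ℓ) ℓ ℓ
Γ S = record
  { Vertex = Σ Carrier (λ x → ¬ (x ≈ 0#) × ∃ (λ y → ¬ (y ≈ 0#) × (x * y) ≈ 0#))
  ; _≈V_ = λ x y → proj₁ x ≈ proj₁ y
  ; Adj = λ x y → (proj₁ x * proj₁ y) ≈ 0# }
  where open CommutativeRing S

ΓI : (R : CommutativeRing c ℓ) → Ideal R i → Graph (c ⊔ i) ℓ i
ΓI R I = record
  { Vertex = Σ Carrier (λ x → ¬ (x ∈I) × ∃ (λ y → ¬ (y ∈I) × (x * y) ∈I))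
  ; _≈V_ = λ x y → proj₁ x ≈ proj₁ y
  ; Adj = λ x y → (proj₁ x * proj₁ y) ∈I }
  where
  open CommutativeRing R
  open Ideal I

record IndependentFamily {v q e} (G : Graph v q e) (A : Set a)
         : Set (a ⊔ v ⊔ q ⊔ e) where
  open Graph G
  field
    vertex      : A → Vertex
    injective   : ∀ x y → vertex x ≈V vertex y → x ≡ y
    independent : ∀ x y → x ≢ y → ¬ Adj (vertex x) (vertex y)

-- α(G) ≤ α(H) (with independent sets indexed by types in universe a):
-- every independent set of G injects into some independent set of H.
IndependenceNumber≤ : (a : Level) {v q e v' q' e' : Level}
  → Graph v q e → Graph v' q' e' → Set (lsuc a ⊔ v ⊔ q ⊔ e ⊔ v' ⊔ q' ⊔ e')
IndependenceNumber≤ a G H =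
  (A : Set a) → IndependentFamily G A →
  Σ (Set a) (λ B → IndependentFamily H B × (A ↣ B))

module Submission where

open import Defs
open import Level using (Level; _⊔_)
open import Algebra.Bundles using (CommutativeRing)
open import Relation.Nullary using (¬_)
open import Data.Product using (_,_)
open import Function.Bundles using (mk↣)

-- In R/I an element is zero exactly when it lies in I, so the identity on the
-- carrier sends zero-divisors of R/I to vertices of Γ_I(R) and reflects both
-- vertex equality and adjacency; hence it maps independent sets of Γ(R/I)
-- injectively onto independent sets of Γ_I(R).

record IndependenceEmbedding {v q e v′ q′ e′ : Level}
         (G : Graph v q e) (H : Graph v′ q′ e′)
         : Set (v ⊔ q ⊔ e ⊔ v′ ⊔ q′ ⊔ e′) where
  open Graph
  field
    map          : Vertex G → Vertex H
    reflects-≈V  : ∀ x y → _≈V_ H (map x) (map y) → _≈V_ G x y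
    reflects-Adj : ∀ x y → Adj H (map x) (map y) → Adj G x y

module _ {v q e v′ q′ e′ : Level} {G : Graph v q e} {H : Graph v′ q′ e′}
         (f : IndependenceEmbedding G H) where
  open IndependenceEmbedding f

  IndependentFamily-map : ∀ {a} {A : Set a} → IndependentFamily G A → IndependentFamily H A
  IndependentFamily-map F = record
    { vertex      = λ x → map (vertex x)
    ; injective   = λ x y eq → injective x y (reflects-≈V (vertex x) (vertex y) eq)
    ; independent = λ x y x≢y adj → independent x y x≢y (reflects-Adj (vertex x) (vertex y) adj)
    }
    where open IndependentFamily F

  IndependenceNumber≤-from-embedding : ∀ a → IndependenceNumber≤ a G H
  IndependenceNumber≤-from-embedding a A F = A , IndependentFamily-map F , mk↣ (λ eq → eq)

module _ {c ℓ i : Level} (R : CommutativeRing c ℓ) (I : Ideal R i) where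
  open CommutativeRing R
  open Ideal I
  open QuotientProofs R I
  open import Algebra.Properties.Ring ring using (-0#≈0#)

  x-0#≈x : ∀ x → x - 0# ≈ x
  x-0#≈x x = trans (+-congˡ -0#≈0#) (+-identityʳ x)

  ~0#⇒∈I : ∀ {x} → x ~ 0# → x ∈I
  ~0#⇒∈I {x} = ∈I-resp (x-0#≈x x)

  ∈I⇒~0# : ∀ {x} → x ∈I → x ~ 0#
  ∈I⇒~0# {x} = ∈I-resp (sym (x-0#≈x x))

  quotient-Γ↪ΓI : IndependenceEmbedding (Γ (R / I)) (ΓI R I)
  quotient-Γ↪ΓI = record
    { map          = λ { (x , x≁0 , y , y≁0 , xy~0) →
                         x , (λ x∈I → x≁0 (∈I⇒~0# x∈I))
                           , y , (λ y∈I → y≁0 (∈I⇒~0# y∈I)) , ~0#⇒∈I xy~0 }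
    ; reflects-≈V  = λ _ _ → ≈⇒~
    ; reflects-Adj = λ _ _ → ∈I⇒~0#
    }

corollary19 : ∀ {a c ℓ i : Level} (R : CommutativeRing c ℓ) (I : Ideal R i)
    → ¬ (CommutativeRing._≈_ R (CommutativeRing.1# R) (CommutativeRing.0# R))
    → IndependenceNumber≤ a (Γ (R / I)) (ΓI R I)
corollary19 {a} R I _ = IndependenceNumber≤-from-embedding (quotient-Γ↪ΓI R I) a
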